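{- Let $k>1$ and consider rowmotion $\rho$ acting on $\mathcal{J}({\sf V}_k)$. For $2\le i\le k$ let $F_i=\chi_{\ell_i}+\chi_{r_i}+\chi_{c_{i-1}}$. Then for every $i$ with $2\le i\le k$, the statistic $F_i-F_{k+2-i}$ is $\frac{3(k+2-2i)}{k+2}$-mesic.
   Context: ${\sf V}$ is the 3-element poset with elements $c,\ell,r$ and relations $c<\ell$, $c<r$. ${\sf V}_k={\sf V}\times[k]$ with the product order, where $[k]=\{1<\dots<k\}$; write $\ell_i=(\ell,i)$, $c_i=(c,i)$, $r_i=(r,i)$. For $s\in{\sf V}_k$, $\chi_s$ is the indicator function on order ideals ($\chi_s(I)=1$ iff $s\in I$). $\mathcal{J}(P)$ is the set of order ideals of $P$; rowmotion $\rho$ sends an order ideal $I$ to the order ideal generated by the minimal elements of $P\setminus I$. A statistic $g$ is $c$-mesic under $\rho$ if its average over every $\rho$-orbit equals $c$. -}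

module Defs where

open import Data.Bool using (Bool; true; false; _∧_; _∨_; not; if_then_else_)
open import Data.Nat using (ℕ; zero; suc; _+_; _∸_; _≤ᵇ_; _≡ᵇ_; NonZero)
open import Data.Fin using (Fin; toℕ)
open import Data.List using (List; _∷_; []; map; concatMap; allFin; upTo; foldr)
open import Data.Bool.ListAction using (any; all)
open import Data.Product using (_×_; _,_; proj₁; proj₂)
open import Data.Integer as ℤ using (ℤ)
open import Data.Rational using (ℚ; _/_)
open import Relation.Binary.PropositionalEquality using (_≡_; _≢_)

data V : Set where
  c ℓ r : V

_≤V_ : V → V → Bool
c ≤V _ = true
ℓ ≤V ℓ = true
r ≤V r = true
_ ≤V _ = false

_≟V_ : V → V → Bool
c ≟V c = true
ℓ ≟V ℓ = true
r ≟V r = true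
_ ≟V _ = false

-- V_k = V × [k]; the level j : Fin k stands for the element j+1 of [k] = {1 < … < k}.
Elem : ℕ → Set
Elem k = V × Fin k

_≤P_ : ∀ {k} → Elem k → Elem k → Bool
(x , i) ≤P (y , j) = (x ≤V y) ∧ (toℕ i ≤ᵇ toℕ j)

_≡P_ : ∀ {k} → Elem k → Elem k → Bool
(x , i) ≡P (y , j) = (x ≟V y) ∧ (toℕ i ≡ᵇ toℕ j)

_<P_ : ∀ {k} → Elem k → Elem k → Bool
a <P b = (a ≤P b) ∧ not (a ≡P b)

elems : (k : ℕ) → List (Elem k)
elems k = concatMap (λ j → (c , j) ∷ (ℓ , j) ∷ (r , j) ∷ []) (allFin k)

Subset : ℕ → Set
Subset k = Elem k → Bool

IsOrderIdeal : ∀ {k} → Subset k → Set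
IsOrderIdeal {k} I = ∀ (a b : Elem k) → (a ≤P b) ≡ true → I b ≡ true → I a ≡ true

minimalOutside : ∀ {k} → Subset k → Elem k → Bool
minimalOutside {k} I m = not (I m) ∧ all (λ z → not (z <P m) ∨ I z) (elems k)

ρ : ∀ {k} → Subset k → Subset k
ρ {k} I y = any (λ m → minimalOutside I m ∧ (y ≤P m)) (elems k)

iter : ∀ {A : Set} → ℕ → (A → A) → A → A
iter zero    f a = a
iter (suc n) f a = f (iter n f a)

_≐_ : ∀ {k} → Subset k → Subset k → Set
_≐_ {k} I J = ∀ (a : Elem k) → I a ≡ J a

IsOrbitSize : ∀ {k} → Subset k → ℕ → Set
IsOrbitSize I p = NonZero p × (iter p ρ I ≐ I)
  × (∀ q → NonZero q → q Data.Nat.< p → (iter q ρ I ≐ I) → Data.Empty.⊥)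
  where import Data.Nat ; import Data.Empty

orbitSum : ∀ {k} → (Subset k → ℤ) → Subset k → ℕ → ℤ
orbitSum g I p = foldr (λ j acc → g (iter j ρ I) ℤ.+ acc) (ℤ.+ 0) (upTo p)

IsMesic : (k : ℕ) → (Subset k → ℤ) → ℚ → Set
IsMesic k g μ = ∀ (I : Subset k) → IsOrderIdeal I → ∀ (p : ℕ) → (o : IsOrbitSize I p) →
  (_/_ (orbitSum g I p) p {{proj₁ o}}) ≡ μ

-- indicator χ_{(x,n)} for x ∈ V and level n ∈ [k] (1-based)
χ : ∀ {k} → V → ℕ → Subset k → ℤ
χ {k} x n I = if any (λ j → (suc (toℕ j) ≡ᵇ n) ∧ I (x , j)) (allFin k) then ℤ.+ 1 else ℤ.+ 0

F : ∀ {k} → ℕ → Subset k → ℤ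
F i I = χ ℓ i I ℤ.+ χ r i I ℤ.+ χ c (i ∸ 1) I

{-# OPTIONS --safe #-}
-- An order ideal of V_k is determined by the heights x, y ≤ z ≤ k of its ℓ-, r- and c-columns,
-- on which rowmotion acts by an explicit rule.  Put markers on the cycle ℤ/(k+2) at x, at y, and at
-- z if both arms are shorter than the centre (at k+1 otherwise).  For x ≠ y rowmotion rotates the
-- multiset of markers by one step; for x = y it rotates the set of the two distinct markers but may
-- exchange which of them is doubled.  On a rotating marker m the indicator of {m ≥ j} equals its
-- mean (k+2-j)/(k+2) up to an explicit coboundary, and F_i differs from the sum of these indicators
-- over the markers by another coboundary.  This yields a potential H with
-- (k+2)(F_i - F_{k+2-i}) = H - H ∘ ρ + 3(k+2-2i), with an extra sliding-window term when x = y;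
-- over an orbit H telescopes.
module Submission where

open import Defs
open import Data.Nat using (ℕ; suc; _≤_; _<_; _+_; _*_; _∸_)
open import Data.Integer as ℤ using (ℤ)
open import Data.Rational using (_/_)

open import Data.Bool using (Bool; true; false; _∧_; _∨_; not; if_then_else_)
open import Data.Bool.Properties
  using (T-≡; T-not-≡; ∧-conicalˡ; ∧-conicalʳ; ∧-comm; ∧-zeroʳ; ∧-identityʳ)
open import Data.Bool.ListAction using (any; all; or; and)
open import Data.Empty using (⊥-elim)
import Data.Fin as Fin
open Fin using (Fin; toℕ; fromℕ<)
open import Data.Fin.Properties using (toℕ<n; toℕ-fromℕ<)
open import Data.List using (List; _∷_; []; allFin; foldr; upTo; map)
open import Data.List.Membership.Propositional using (_∈_; lose)
open import Data.List.Membership.Propositional.Properties using (∈-allFin; ∈-concatMap⁺)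
open import Data.List.Properties using (map-cong; map-upTo; foldr-map)
open import Data.List.Relation.Unary.Any using (here; there; satisfied)
open import Data.List.Relation.Unary.Any.Properties using (any⁺; any⁻)
import Data.List.Relation.Unary.All as All
open import Data.List.Relation.Unary.All.Properties using (all⁺; all⁻)
open import Data.Nat using (zero; z≤n; s≤s; _≤ᵇ_; _≡ᵇ_; _⊔_)
open import Data.Nat.Properties
open import Data.Product using (_×_; _,_; proj₁; proj₂; ∃-syntax)
open import Data.Sum using (_⊎_; inj₁; inj₂)
open import Function using (_∘_; Equivalence)
open import Relation.Binary.PropositionalEquality
open import Relation.Nullary using (¬_; yes; no)
open import Relation.Binary.Definitions using (tri<; tri≈; tri>)
import Data.Integer.Properties as ℤ
import Data.Rational.Properties as ℚ
import Data.Rational.Unnormalised as ℚᵘ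
open import Data.Integer.Tactic.RingSolver using (solve-∀)
open import Algebra.Properties.CommutativeSemigroup ℤ.+-commutativeSemigroup
  using (xy∙z≈zy∙x; xy∙z≈xz∙y)

open Equivalence

true≢false : true ≢ false
true≢false ()

≤ᵇ-true : ∀ {m n} → m ≤ n → (m ≤ᵇ n) ≡ true
≤ᵇ-true m≤n = T-≡ .to (≤⇒≤ᵇ m≤n)

≤ᵇ-true⁻ : ∀ {m n} → (m ≤ᵇ n) ≡ true → m ≤ n
≤ᵇ-true⁻ {m} {n} eq = ≤ᵇ⇒≤ m n (T-≡ .from eq)

≤ᵇ-false : ∀ {m n} → n < m → (m ≤ᵇ n) ≡ false
≤ᵇ-false {m} {n} n<m with m ≤ᵇ n in eq
... | false = refl
... | true  = ⊥-elim (<⇒≱ n<m (≤ᵇ-true⁻ eq))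

≤ᵇ-false⁻ : ∀ {m n} → (m ≤ᵇ n) ≡ false → n < m
≤ᵇ-false⁻ eq = ≰⇒> λ m≤n → true≢false (trans (sym (≤ᵇ-true m≤n)) eq)

≡ᵇ-false : ∀ {m n} → m ≢ n → (m ≡ᵇ n) ≡ false
≡ᵇ-false {m} {n} m≢n with m ≡ᵇ n in eq
... | true  = ⊥-elim (m≢n (≡ᵇ⇒≡ m n (T-≡ .from eq)))
... | false = refl

≡ᵇ-refl : ∀ m → (m ≡ᵇ m) ≡ true
≡ᵇ-refl m = T-≡ .to (≡⇒≡ᵇ m m refl)

bool-ext : ∀ {a b} → (a ≡ true → b ≡ true) → (b ≡ true → a ≡ true) → a ≡ b
bool-ext {true}  {true}  _ _ = refl
bool-ext {true}  {false} f _ = sym (f refl)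
bool-ext {false} {true}  _ g = g refl
bool-ext {false} {false} _ _ = refl

any-true⁺ : ∀ {A : Set} (p : A → Bool) {x xs} → x ∈ xs → p x ≡ true → any p xs ≡ true
any-true⁺ p x∈xs px = T-≡ .to (any⁺ p (lose x∈xs (T-≡ .from px)))

any-true⁻ : ∀ {A : Set} (p : A → Bool) xs → any p xs ≡ true → ∃[ x ] p x ≡ true
any-true⁻ p xs h with satisfied (any⁻ p xs (T-≡ .from h))
... | x , px = x , T-≡ .to px

all-true⁺ : ∀ {A : Set} (p : A → Bool) xs → (∀ x → p x ≡ true) → all p xs ≡ true
all-true⁺ p xs h = T-≡ .to (all⁻ p {xs} (All.tabulate λ {x} _ → T-≡ .from (h x)))

all-true⁻ : ∀ {A : Set} (p : A → Bool) {x xs} → x ∈ xs → all p xs ≡ true → p x ≡ true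
all-true⁻ p {xs = xs} x∈xs h = T-≡ .to (All.lookup (all⁺ p xs (T-≡ .from h)) x∈xs)

∈-elems : ∀ {k} (e : Elem k) → e ∈ elems k
∈-elems (v , j) = ∈-concatMap⁺ column (lose (∈-allFin j) (∈-column v))
  where
  column : Fin _ → List (Elem _)
  column j = (c , j) ∷ (ℓ , j) ∷ (r , j) ∷ []
  ∈-column : ∀ v → (v , j) ∈ column j
  ∈-column c = here refl
  ∈-column ℓ = there (here refl)
  ∈-column r = there (there (here refl))

≤V-refl : ∀ v → (v ≤V v) ≡ true
≤V-refl c = refl
≤V-refl ℓ = refl
≤V-refl r = refl

≟V-refl : ∀ v → (v ≟V v) ≡ true
≟V-refl c = refl
≟V-refl ℓ = refl
≟V-refl r = refl

<P⁺ : ∀ {k} v (a j : Fin k) → toℕ a < toℕ j → ((v , a) <P (v , j)) ≡ true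
<P⁺ v a j a<j rewrite ≤V-refl v | ≟V-refl v | ≤ᵇ-true (<⇒≤ a<j)
  | ≡ᵇ-false (<⇒≢ a<j) = refl

≤∧≢ᵇ⇒< : ∀ {m n} → ((m ≤ᵇ n) ∧ not (m ≡ᵇ n)) ≡ true → m < n
≤∧≢ᵇ⇒< {m} {n} h = ≤∧≢⇒< (≤ᵇ-true⁻ (∧-conicalˡ _ _ h)) λ m≡n →
  true≢false (trans (sym (T-≡ .to (≡⇒≡ᵇ m n m≡n)))
                    (T-not-≡ .to (T-≡ .from (∧-conicalʳ (m ≤ᵇ n) _ h))))

<P⁻ : ∀ {k} w v (a j : Fin k) → ((w , a) <P (v , j)) ≡ true →
  (w ≡ v × toℕ a < toℕ j) ⊎ (w ≡ c × v ≢ c × toℕ a ≤ toℕ j)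
<P⁻ c c a j h = inj₁ (refl , ≤∧≢ᵇ⇒< h)
<P⁻ ℓ ℓ a j h = inj₁ (refl , ≤∧≢ᵇ⇒< h)
<P⁻ r r a j h = inj₁ (refl , ≤∧≢ᵇ⇒< h)
<P⁻ c ℓ a j h = inj₂ (refl , (λ ()) , ≤ᵇ-true⁻ (∧-conicalˡ _ true h))
<P⁻ c r a j h = inj₂ (refl , (λ ()) , ≤ᵇ-true⁻ (∧-conicalˡ _ true h))
<P⁻ ℓ c a j ()
<P⁻ ℓ r a j ()
<P⁻ r c a j ()
<P⁻ r ℓ a j ()

ρ-cong : ∀ {k} {I J : Subset k} → I ≐ J → ρ I ≐ ρ J
ρ-cong {k} {I} {J} I≐J e = cong or (map-cong minimal-cong (elems k))
  where
  minimal-cong : ∀ m → (minimalOutside I m ∧ (e ≤P m)) ≡ (minimalOutside J m ∧ (e ≤P m))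
  minimal-cong m = cong (_∧ (e ≤P m)) (cong₂ _∧_ (cong not (I≐J m))
    (cong and (map-cong (λ w → cong (not (w <P m) ∨_) (I≐J w)) (elems k))))

minimalOutside⁺ : ∀ {k} (I : Subset k) m → I m ≡ false →
  (∀ w → (w <P m) ≡ true → I w ≡ true) → minimalOutside I m ≡ true
minimalOutside⁺ {k} I m m∉I below = cong₂ _∧_ (cong not m∉I) (all-true⁺ _ (elems k) covered)
  where
  covered : ∀ w → (not (w <P m) ∨ I w) ≡ true
  covered w with w <P m in w<m
  ... | true  = below w w<m
  ... | false = refl

minimalOutside⁻ : ∀ {k} (I : Subset k) m → minimalOutside I m ≡ true →
  I m ≡ false × (∀ w → (w <P m) ≡ true → I w ≡ true)
minimalOutside⁻ {k} I m h = T-not-≡ .to (T-≡ .from (∧-conicalˡ _ _ h)) , below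
  where
  below : ∀ w → (w <P m) ≡ true → I w ≡ true
  below w w<m
    with covered ← all-true⁻ (λ w → not (w <P m) ∨ I w) (∈-elems w) (∧-conicalʳ _ _ h)
    rewrite w<m = covered

ρ⁺ : ∀ {k} (I : Subset k) e m →
  minimalOutside I m ≡ true → (e ≤P m) ≡ true → ρ I e ≡ true
ρ⁺ I e m min e≤m = any-true⁺ _ (∈-elems m) (cong₂ _∧_ min e≤m)

ρ⁻ : ∀ {k} (I : Subset k) e → ρ I e ≡ true →
  ∃[ m ] minimalOutside I m ≡ true × (e ≤P m) ≡ true
ρ⁻ {k} I e h with any-true⁻ _ (elems k) h
... | m , min∧e≤m =
  m , ∧-conicalˡ _ (e ≤P m) min∧e≤m , ∧-conicalʳ (minimalOutside I m) _ min∧e≤m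

-- Order ideals of V_k as column heights

Heights : Set
Heights = ℕ × ℕ × ℕ

height : Heights → V → ℕ
height (x , y , z) ℓ = x
height (x , y , z) r = y
height (x , y , z) c = z

ideal : ∀ {k} → Heights → Subset k
ideal t (v , j) = suc (toℕ j) ≤ᵇ height t v

record Admissible (k : ℕ) (t : Heights) : Set where
  field
    arm≤centre : ∀ v → height t v ≤ height t c
    centre≤k   : height t c ≤ k

  height≤k : ∀ v → height t v ≤ k
  height≤k v = ≤-trans (arm≤centre v) centre≤k

open Admissible

-- The minimal elements of the complement of ideal t are the cells (v , height t v) with v addable.
Addable : ℕ → Heights → V → Set
Addable k t c = height t c < k
Addable k t ℓ = height t ℓ < height t c
Addable k t r = height t r < height t c

addable-arm : ∀ {k} t v → v ≢ c → Addable k t v → height t v < height t c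
addable-arm t c c≢c _ = ⊥-elim (c≢c refl)
addable-arm t ℓ _ add = add
addable-arm t r _ add = add

addable<k : ∀ {k t} → Admissible k t → ∀ v → Addable k t v → height t v < k
addable<k adm c add = add
addable<k adm ℓ add = <-≤-trans add (adm .centre≤k)
addable<k adm r add = <-≤-trans add (adm .centre≤k)

columnHeight : ∀ n → (Fin n → Bool) → ℕ
columnHeight zero    f = 0
columnHeight (suc n) f = if f Fin.zero then suc (columnHeight n (f ∘ Fin.suc)) else 0

DownClosed : ∀ {n} → (Fin n → Bool) → Set
DownClosed f = ∀ i j → toℕ i ≤ toℕ j → f j ≡ true → f i ≡ true

columnHeight-spec : ∀ n (f : Fin n → Bool) → DownClosed f →
  ∀ j → f j ≡ (suc (toℕ j) ≤ᵇ columnHeight n f)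
columnHeight-spec (suc n) f closed j with f Fin.zero in f0
columnHeight-spec (suc n) f closed j | false with f j in fj
... | false = refl
... | true  = ⊥-elim (true≢false (trans (sym (closed Fin.zero j z≤n fj)) f0))
columnHeight-spec (suc n) f closed Fin.zero    | true = f0
columnHeight-spec (suc n) f closed (Fin.suc j) | true =
  columnHeight-spec n (f ∘ Fin.suc) (λ i j i≤j → closed (Fin.suc i) (Fin.suc j) (s≤s i≤j)) j

columnHeight≤ : ∀ n (f : Fin n → Bool) → columnHeight n f ≤ n
columnHeight≤ zero    f = z≤n
columnHeight≤ (suc n) f with f Fin.zero
... | false = z≤n
... | true  = s≤s (columnHeight≤ n (f ∘ Fin.suc))

columnHeight-mono : ∀ n {f g : Fin n → Bool} → (∀ j → f j ≡ true → g j ≡ true) →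
  columnHeight n f ≤ columnHeight n g
columnHeight-mono zero    f⊆g = z≤n
columnHeight-mono (suc n) {f} {g} f⊆g with f Fin.zero in f0
... | false = z≤n
... | true rewrite f⊆g Fin.zero f0 = s≤s (columnHeight-mono n (f⊆g ∘ Fin.suc))

columnHeight-cong : ∀ n {f g : Fin n → Bool} → (∀ j → f j ≡ g j) →
  columnHeight n f ≡ columnHeight n g
columnHeight-cong n f≗g = ≤-antisym (columnHeight-mono n (λ j → trans (sym (f≗g j))))
                                    (columnHeight-mono n (λ j → trans (f≗g j)))

columnHeight-threshold : ∀ n h → h ≤ n → columnHeight n (λ j → suc (toℕ j) ≤ᵇ h) ≡ h
columnHeight-threshold zero    zero    _         = refl
columnHeight-threshold (suc n) zero    _         = refl
columnHeight-threshold (suc n) (suc h) (s≤s h≤n) = cong suc (columnHeight-threshold n h h≤n)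

heights : ∀ {k} → Subset k → Heights
heights {k} I = column ℓ , column r , column c
  where column : V → ℕ
        column v = columnHeight k (λ j → I (v , j))

height-heights : ∀ {k} (I : Subset k) v →
  height (heights I) v ≡ columnHeight k (λ j → I (v , j))
height-heights I c = refl
height-heights I ℓ = refl
height-heights I r = refl

ideal-heights : ∀ {k} (I : Subset k) → IsOrderIdeal I → I ≐ ideal (heights I)
ideal-heights {k} I isIdeal (v , j) =
  trans (columnHeight-spec k (λ j → I (v , j)) column-closed j)
        (cong (suc (toℕ j) ≤ᵇ_) (sym (height-heights I v)))
  where
  column-closed : DownClosed (λ j → I (v , j))
  column-closed i j i≤j = isIdeal (v , i) (v , j) (cong₂ _∧_ (≤V-refl v) (≤ᵇ-true i≤j))

admissible-heights : ∀ {k} (I : Subset k) → IsOrderIdeal I → Admissible k (heights I)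
admissible-heights {k} I isIdeal = record
  { arm≤centre = λ v → subst₂ _≤_ (sym (height-heights I v)) refl
      (columnHeight-mono k (λ j → isIdeal (c , j) (v , j) (≤ᵇ-true (≤-refl {toℕ j}))))
  ; centre≤k = columnHeight≤ k _ }

heights-ideal : ∀ {k t} → Admissible k t → heights (ideal {k} t) ≡ t
heights-ideal {k} {x , y , z} adm =
  cong₂ _,_ (columnHeight-threshold k x (height≤k adm ℓ))
    (cong₂ _,_ (columnHeight-threshold k y (height≤k adm r))
               (columnHeight-threshold k z (adm .centre≤k)))

heights-cong : ∀ {k} {I J : Subset k} → I ≐ J → heights I ≡ heights J
heights-cong {k} {I} {J} I≐J =
  cong₂ _,_ (column-cong ℓ) (cong₂ _,_ (column-cong r) (column-cong c))
  where
  column-cong : ∀ v → columnHeight k (λ j → I (v , j)) ≡ columnHeight k (λ j → J (v , j))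
  column-cong v = columnHeight-cong k (λ j → I≐J (v , j))

-- Rowmotion on heights

minimalOutside-ideal⁺ : ∀ {k} t v (j : Fin k) → toℕ j ≡ height t v → Addable k t v →
  minimalOutside (ideal t) (v , j) ≡ true
minimalOutside-ideal⁺ t v j j≡h add =
  minimalOutside⁺ (ideal t) (v , j) (≤ᵇ-false (subst (_< suc (toℕ j)) j≡h (n<1+n _))) below
  where
  below : ∀ w → (w <P (v , j)) ≡ true → ideal t w ≡ true
  below (w , a) w<vj with <P⁻ w v a j w<vj
  ... | inj₁ (refl , a<j)       = ≤ᵇ-true (subst (toℕ a <_) j≡h a<j)
  ... | inj₂ (refl , v≢c , a≤j) =
    ≤ᵇ-true (≤-<-trans (subst (toℕ a ≤_) j≡h a≤j) (addable-arm t v v≢c add))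

minimalOutside-ideal-height : ∀ {k} t v (j : Fin k) → minimalOutside (ideal t) (v , j) ≡ true →
  toℕ j ≡ height t v
minimalOutside-ideal-height {k} t v j min =
  ≤-antisym (≮⇒≥ j≯h) (<⇒≤pred (≤ᵇ-false⁻ j∉I))
  where
  j∉I : ideal t (v , j) ≡ false
  j∉I = proj₁ (minimalOutside⁻ (ideal t) (v , j) min)
  below : ∀ w → (w <P (v , j)) ≡ true → ideal t w ≡ true
  below = proj₂ (minimalOutside⁻ (ideal t) (v , j) min)
  j≯h : ¬ (height t v < toℕ j)
  j≯h h<j =
    n≮n (height t v) (subst (_≤ height t v) (cong suc (toℕ-fromℕ< h<k)) (≤ᵇ-true⁻ h∈I))
    where
    h<k = <-trans h<j (toℕ<n j)
    h∈I : ideal t (v , fromℕ< h<k) ≡ true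
    h∈I = below (v , fromℕ< h<k) (<P⁺ v _ j (subst (_< toℕ j) (sym (toℕ-fromℕ< h<k)) h<j))

centre<P-arm : ∀ {k} v (j : Fin k) → v ≢ c → ((c , j) <P (v , j)) ≡ true
centre<P-arm c j c≢c = ⊥-elim (c≢c refl)
centre<P-arm ℓ j _ = cong (_∧ true) (≤ᵇ-true (≤-refl {toℕ j}))
centre<P-arm r j _ = cong (_∧ true) (≤ᵇ-true (≤-refl {toℕ j}))

minimalOutside-ideal-arm : ∀ {k} t v (j : Fin k) → v ≢ c →
  minimalOutside (ideal t) (v , j) ≡ true → height t v < height t c
minimalOutside-ideal-arm t v j v≢c min =
  subst (_< height t c) (minimalOutside-ideal-height t v j min)
    (≤ᵇ-true⁻ (proj₂ (minimalOutside⁻ (ideal t) (v , j) min) (c , j) (centre<P-arm v j v≢c)))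

minimalOutside-ideal⁻ : ∀ {k} t v (j : Fin k) → minimalOutside (ideal t) (v , j) ≡ true →
  toℕ j ≡ height t v × Addable k t v
minimalOutside-ideal⁻ t c j min = j≡h , subst (_< _) j≡h (toℕ<n j)
  where j≡h = minimalOutside-ideal-height t c j min
minimalOutside-ideal⁻ t ℓ j min =
  minimalOutside-ideal-height t ℓ j min , minimalOutside-ideal-arm t ℓ j (λ ()) min
minimalOutside-ideal⁻ t r j min =
  minimalOutside-ideal-height t r j min , minimalOutside-ideal-arm t r j (λ ()) min

advance : ℕ → ℕ → ℕ
advance x z = if suc x ≤ᵇ z then suc x else 0

-- When the centre column is full, the new ideal is generated by the tops of the arms alone.
ρᴴ : ℕ → Heights → Heights
ρᴴ k (x , y , z) =
  advance x z , advance y z , (if suc z ≤ᵇ k then suc z else advance x z ⊔ advance y z)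

advance-< : ∀ {x z} → x < z → advance x z ≡ suc x
advance-< x<z rewrite ≤ᵇ-true x<z = refl

advance-≥ : ∀ {x z} → z ≤ x → advance x z ≡ 0
advance-≥ z≤x rewrite ≤ᵇ-false (s≤s z≤x) = refl

advance≤ : ∀ x z → advance x z ≤ z
advance≤ x z with suc x ≤ᵇ z in x<z
... | true  = ≤ᵇ-true⁻ x<z
... | false = z≤n

advance⁻ : ∀ {a} x z → suc a ≤ advance x z → x < z × a ≤ x
advance⁻ x z h with suc x ≤ᵇ z in x<z
advance⁻ x z (s≤s a≤x) | true = ≤ᵇ-true⁻ x<z , a≤x

advance-injective : ∀ {x y z} → x ≤ z → y ≤ z → advance x z ≡ advance y z → x ≡ y
advance-injective x≤z y≤z eq with m≤n⇒m<n∨m≡n x≤z | m≤n⇒m<n∨m≡n y≤z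
... | inj₁ x<z  | inj₁ y<z  = suc-injective (trans (sym (advance-< x<z)) (trans eq (advance-< y<z)))
... | inj₁ x<z  | inj₂ refl =
  ⊥-elim (0≢1+n (trans (sym (advance-≥ ≤-refl)) (trans (sym eq) (advance-< x<z))))
... | inj₂ refl | inj₁ y<z  =
  ⊥-elim (0≢1+n (trans (sym (advance-≥ ≤-refl)) (trans eq (advance-< y<z))))
... | inj₂ refl | inj₂ refl = refl

centre-< : ∀ {k} x y {z} → z < k → height (ρᴴ k (x , y , z)) c ≡ suc z
centre-< x y z<k rewrite ≤ᵇ-true z<k = refl

centre-top : ∀ k x y → height (ρᴴ k (x , y , k)) c ≡ advance x k ⊔ advance y k
centre-top k x y rewrite ≤ᵇ-false (n<1+n k) = refl

admissible-ρᴴ : ∀ {k t} → Admissible k t → Admissible k (ρᴴ k t)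
admissible-ρᴴ {k} {x , y , z} adm with m≤n⇒m<n∨m≡n (adm .centre≤k)
... | inj₁ z<k rewrite centre-< {k} x y z<k = record
  { arm≤centre = λ { c → ≤-refl
                    ; ℓ → m≤n⇒m≤1+n (advance≤ x z)
                    ; r → m≤n⇒m≤1+n (advance≤ y z) }
  ; centre≤k   = z<k }
... | inj₂ refl rewrite centre-top z x y = record
  { arm≤centre = λ { c → ≤-refl ; ℓ → m≤m⊔n (advance x z) _ ; r → m≤n⊔m _ (advance y z) }
  ; centre≤k   = ⊔-lub (advance≤ x z) (advance≤ y z) }

ρᴴ-grows : ∀ {k t} → Admissible k t → ∀ w v → (w ≤V v) ≡ true → Addable k t v →
  suc (height t v) ≤ height (ρᴴ k t) w
ρᴴ-grows {t = x , y , z} adm c c _ add = ≤-reflexive (sym (centre-< x y add))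
ρᴴ-grows {t = x , y , z} adm ℓ ℓ _ add = ≤-reflexive (sym (advance-< add))
ρᴴ-grows {t = x , y , z} adm r r _ add = ≤-reflexive (sym (advance-< add))
ρᴴ-grows {t = t} adm c ℓ _ add =
  ≤-trans (ρᴴ-grows {t = t} adm ℓ ℓ refl add) (admissible-ρᴴ adm .arm≤centre ℓ)
ρᴴ-grows {t = t} adm c r _ add =
  ≤-trans (ρᴴ-grows {t = t} adm r r refl add) (admissible-ρᴴ adm .arm≤centre r)

ρᴴ-covered : ∀ {k t} → Admissible k t → ∀ w a → suc a ≤ height (ρᴴ k t) w →
  ∃[ v ] (w ≤V v) ≡ true × a ≤ height t v × Addable k t v
ρᴴ-covered {t = x , y , z} adm ℓ a h with advance⁻ x z h
... | x<z , a≤x = ℓ , refl , a≤x , x<z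
ρᴴ-covered {t = x , y , z} adm r a h with advance⁻ y z h
... | y<z , a≤y = r , refl , a≤y , y<z
ρᴴ-covered {k} {x , y , z} adm c a h with m≤n⇒m<n∨m≡n (adm .centre≤k)
... | inj₁ z<k = c , refl , ≤-pred (subst (suc a ≤_) (centre-< x y z<k) h) , z<k
... | inj₂ refl with ⊔-sel (advance x z) (advance y z)
...   | inj₁ eq with advance⁻ x z (subst (suc a ≤_) (trans (centre-top z x y) eq) h)
...     | x<z , a≤x = ℓ , refl , a≤x , x<z
ρᴴ-covered {k} {x , y , z} adm c a h | inj₂ refl | inj₂ eq
  with advance⁻ y z (subst (suc a ≤_) (trans (centre-top z x y) eq) h)
...     | y<z , a≤y = r , refl , a≤y , y<z

ρ-ideal : ∀ {k t} → Admissible k t → ρ (ideal t) ≐ ideal (ρᴴ k t)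
ρ-ideal {k} {t} adm (w , a) = bool-ext into onto
  where
  into : ρ (ideal t) (w , a) ≡ true → ideal (ρᴴ k t) (w , a) ≡ true
  into h with ρ⁻ (ideal t) (w , a) h
  ... | (v , j) , min , w≤v with minimalOutside-ideal⁻ t v j min
  ... | j≡h , add = ≤ᵇ-true (≤-trans (s≤s a≤h) (ρᴴ-grows adm w v (∧-conicalˡ _ _ w≤v) add))
    where a≤h = subst (toℕ a ≤_) j≡h (≤ᵇ-true⁻ (∧-conicalʳ (w ≤V v) _ w≤v))
  onto : ideal (ρᴴ k t) (w , a) ≡ true → ρ (ideal t) (w , a) ≡ true
  onto h with ρᴴ-covered adm w (toℕ a) (≤ᵇ-true⁻ h)
  ... | v , w≤v , a≤h , add =
    ρ⁺ (ideal t) (w , a) (v , j) (minimalOutside-ideal⁺ t v j (toℕ-fromℕ< h<k) add)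
      (cong₂ _∧_ w≤v (≤ᵇ-true (subst (toℕ a ≤_) (sym (toℕ-fromℕ< h<k)) a≤h)))
    where
    h<k = addable<k adm v add
    j = fromℕ< h<k

admissible-iter : ∀ {k t} → Admissible k t → ∀ n → Admissible k (iter n (ρᴴ k) t)
admissible-iter adm zero    = adm
admissible-iter adm (suc n) = admissible-ρᴴ (admissible-iter adm n)

iter-ideal : ∀ {k t} (I : Subset k) → Admissible k t → I ≐ ideal t →
  ∀ n → iter n ρ I ≐ ideal (iter n (ρᴴ k) t)
iter-ideal I adm I≐t zero      = I≐t
iter-ideal I adm I≐t (suc n) e =
  trans (ρ-cong (iter-ideal I adm I≐t n) e) (ρ-ideal (admissible-iter adm n) e)

𝟙 : Bool → ℤ
𝟙 b = if b then ℤ.+ 1 else ℤ.+ 0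

𝟙-≤ᵇ-true : ∀ {m n} → m ≤ n → 𝟙 (m ≤ᵇ n) ≡ ℤ.+ 1
𝟙-≤ᵇ-true m≤n rewrite ≤ᵇ-true m≤n = refl

𝟙-≤ᵇ-false : ∀ {m n} → n < m → 𝟙 (m ≤ᵇ n) ≡ ℤ.+ 0
𝟙-≤ᵇ-false n<m rewrite ≤ᵇ-false n<m = refl

𝟙-complement : ∀ m n → 𝟙 (suc n ≤ᵇ m) ≡ ℤ.+ 1 ℤ.- 𝟙 (m ≤ᵇ n)
𝟙-complement m n with m ≤? n
... | yes m≤n rewrite 𝟙-≤ᵇ-false (s≤s m≤n) | 𝟙-≤ᵇ-true m≤n = refl
... | no m≰n rewrite 𝟙-≤ᵇ-true (≰⇒> m≰n) | 𝟙-≤ᵇ-false (≰⇒> m≰n) = refl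

χ-cong : ∀ {k} v n {I J : Subset k} → I ≐ J → χ v n I ≡ χ v n J
χ-cong {k} v n I≐J =
  cong 𝟙 (cong or (map-cong (λ j → cong ((suc (toℕ j) ≡ᵇ n) ∧_) (I≐J (v , j))) (allFin k)))

F-cong : ∀ {k} i {I J : Subset k} → I ≐ J → F i I ≡ F i J
F-cong i I≐J =
  cong₂ ℤ._+_ (cong₂ ℤ._+_ (χ-cong ℓ i I≐J) (χ-cong r i I≐J)) (χ-cong c (i ∸ 1) I≐J)

χ-ideal : ∀ {k} t v n → height t v ≤ k → χ v (suc n) (ideal {k} t) ≡ 𝟙 (suc n ≤ᵇ height t v)
χ-ideal {k} t v n h≤k = cong 𝟙 (bool-ext into onto)
  where
  hit : Bool
  hit = any (λ j → (suc (toℕ j) ≡ᵇ suc n) ∧ ideal t (v , j)) (allFin k)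
  into : hit ≡ true → (suc n ≤ᵇ height t v) ≡ true
  into h with any-true⁻ _ (allFin k) h
  ... | j , at-n∧in = ≤ᵇ-true (subst (_≤ height t v)
          (≡ᵇ⇒≡ _ _ (T-≡ .from (∧-conicalˡ _ _ at-n∧in)))
          (≤ᵇ-true⁻ (∧-conicalʳ (suc (toℕ j) ≡ᵇ suc n) _ at-n∧in)))
  onto : (suc n ≤ᵇ height t v) ≡ true → hit ≡ true
  onto h = any-true⁺ _ (∈-allFin (fromℕ< n<k))
    (cong₂ _∧_ (T-≡ .to (≡⇒≡ᵇ _ _ (cong suc (toℕ-fromℕ< n<k))))
               (≤ᵇ-true (subst (λ m → suc m ≤ height t v) (sym (toℕ-fromℕ< n<k))
                               (≤ᵇ-true⁻ h))))
    where n<k = <-≤-trans (≤ᵇ-true⁻ h) h≤k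

Fᴴ : ℕ → Heights → ℤ
Fᴴ i (x , y , z) = 𝟙 (i ≤ᵇ x) ℤ.+ 𝟙 (i ≤ᵇ y) ℤ.+ 𝟙 (i ∸ 1 ≤ᵇ z)

F-ideal : ∀ {k t} i → 2 ≤ i → Admissible k t → F i (ideal {k} t) ≡ Fᴴ i t
F-ideal {t = t@(x , y , z)} (suc (suc j)) (s≤s (s≤s z≤n)) adm =
  cong₂ ℤ._+_ (cong₂ ℤ._+_ (χ-ideal t ℓ (suc j) (height≤k adm ℓ))
                           (χ-ideal t r (suc j) (height≤k adm r)))
              (χ-ideal t c j (adm .centre≤k))

-- The markers of t are its arm heights x, y and its centreMarker; they live on the cycle
-- {0, …, k + 1}, on which rotate k is the successor map.
rotate : ℕ → ℕ → ℕ
rotate k m = if m ≡ᵇ suc k then 0 else suc m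

rotate-≤ : ∀ {k m} → m ≤ k → rotate k m ≡ suc m
rotate-≤ {k} m≤k rewrite ≡ᵇ-false (<⇒≢ (s≤s m≤k)) = refl

rotate-top : ∀ k → rotate k (suc k) ≡ 0
rotate-top k rewrite ≡ᵇ-refl (suc k) = refl

rotate-injective : ∀ {k m n} → m ≤ suc k → n ≤ suc k → rotate k m ≡ rotate k n → m ≡ n
rotate-injective {k} m≤ n≤ eq with m≤n⇒m<n∨m≡n m≤ | m≤n⇒m<n∨m≡n n≤
... | inj₁ (s≤s m≤k) | inj₁ (s≤s n≤k) =
  suc-injective (trans (sym (rotate-≤ m≤k)) (trans eq (rotate-≤ n≤k)))
... | inj₁ (s≤s m≤k) | inj₂ refl =
  ⊥-elim (0≢1+n (trans (sym (rotate-top k)) (trans (sym eq) (rotate-≤ m≤k))))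
... | inj₂ refl | inj₁ (s≤s n≤k) =
  ⊥-elim (0≢1+n (trans (sym (rotate-top k)) (trans eq (rotate-≤ n≤k))))
... | inj₂ refl | inj₂ refl = refl

centreMarker : ℕ → Heights → ℕ
centreMarker k (x , y , z) = if suc (x ⊔ y) ≤ᵇ z then z else suc k

centreMarker-< : ∀ k {x y z} → x < z → y < z → centreMarker k (x , y , z) ≡ z
centreMarker-< k x<z y<z rewrite ≤ᵇ-true (⊔-lub x<z y<z) = refl

centreMarker-≥ : ∀ k x y {z} → z ≤ x ⊔ y → centreMarker k (x , y , z) ≡ suc k
centreMarker-≥ k x y z≤x⊔y rewrite ≤ᵇ-false (s≤s z≤x⊔y) = refl

centreMarker≤ : ∀ {k t} → Admissible k t → centreMarker k t ≤ suc k
centreMarker≤ {k} {x , y , z} adm with suc (x ⊔ y) ≤ᵇ z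
... | true  = m≤n⇒m≤1+n (adm .centre≤k)
... | false = ≤-refl

arm≤centreMarker : ∀ {k t} → Admissible k t → ∀ v → height t v ≤ centreMarker k t
arm≤centreMarker {k} {x , y , z} adm v with suc (x ⊔ y) ≤ᵇ z
... | true  = adm .arm≤centre v
... | false = m≤n⇒m≤1+n (height≤k adm v)

centreMarker-ρᴴ : ∀ {k t} → Admissible k t → centreMarker k (ρᴴ k t) ≡ rotate k (height t c)
centreMarker-ρᴴ {k} {x , y , z} adm with m≤n⇒m<n∨m≡n (adm .centre≤k)
... | inj₁ z<k = begin
  centreMarker k (advance x z , advance y z , height (ρᴴ k (x , y , z)) c)
    ≡⟨ cong (λ h → centreMarker k (advance x z , advance y z , h)) (centre-< x y z<k) ⟩
  centreMarker k (advance x z , advance y z , suc z)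
    ≡⟨ centreMarker-< k (s≤s (advance≤ x z)) (s≤s (advance≤ y z)) ⟩
  suc z
    ≡⟨ rotate-≤ (<⇒≤ z<k) ⟨
  rotate k z ∎
  where open ≡-Reasoning
... | inj₂ refl =
  trans (cong (λ h → centreMarker z (advance x z , advance y z , h)) (centre-top z x y))
        (trans (centreMarker-≥ z (advance x z) (advance y z) ≤-refl) (sym (rotate-≤ ≤-refl)))

arms-rotate-injective : ∀ {k x y z} → Admissible k (x , y , z) → rotate k x ≡ rotate k y → x ≡ y
arms-rotate-injective adm =
  rotate-injective (m≤n⇒m≤1+n (height≤k adm ℓ)) (m≤n⇒m≤1+n (height≤k adm r))

-- Relates the rotated markers (a , b , s) of t to the markers (a′ , b′ , s′) of ρᴴ k t: they agree
-- up to a permutation when a ≢ b, while twin exchanges the doubled and the single marker.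
data MarkerStep (a b s a′ b′ s′ : ℕ) : Set where
  fixed : a′ ≡ a → b′ ≡ b → s′ ≡ s → MarkerStep a b s a′ b′ s′
  swapˡ : a ≢ b → a′ ≡ s → b′ ≡ b → s′ ≡ a → MarkerStep a b s a′ b′ s′
  swapʳ : a ≢ b → a′ ≡ a → b′ ≡ s → s′ ≡ b → MarkerStep a b s a′ b′ s′
  twin  : a ≡ b → a′ ≡ s → b′ ≡ s → s′ ≡ a → MarkerStep a b s a′ b′ s′

short-arm : ∀ {k a z} → a < z → z ≤ k → advance a z ≡ rotate k a
short-arm a<z z≤k = trans (advance-< a<z) (sym (rotate-≤ (≤-trans (<⇒≤ a<z) z≤k)))

full-arm : ∀ k x y {z} → z ≤ x ⊔ y → advance z z ≡ rotate k (centreMarker k (x , y , z))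
full-arm k x y z≤x⊔y =
  trans (advance-≥ ≤-refl) (sym (trans (cong (rotate k) (centreMarker-≥ k x y z≤x⊔y)) (rotate-top k)))

markerStep : ∀ {k} x y z → Admissible k (x , y , z) →
  MarkerStep (rotate k x) (rotate k y) (rotate k (centreMarker k (x , y , z)))
             (advance x z) (advance y z) (centreMarker k (ρᴴ k (x , y , z)))
markerStep {k} x y z adm
  with m≤n⇒m<n∨m≡n (adm .arm≤centre ℓ) | m≤n⇒m<n∨m≡n (adm .arm≤centre r)
... | inj₁ x<z | inj₁ y<z = fixed (short-arm x<z z≤k) (short-arm y<z z≤k)
  (trans (centreMarker-ρᴴ adm) (cong (rotate k) (sym (centreMarker-< k x<z y<z))))
  where z≤k = adm .centre≤k
... | inj₂ refl | inj₁ y<x = swapˡ (λ eq → <⇒≢ y<x (sym (arms-rotate-injective adm eq)))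
  (full-arm k x y (m≤m⊔n x y)) (short-arm y<x (adm .centre≤k)) (centreMarker-ρᴴ adm)
... | inj₁ x<y | inj₂ refl = swapʳ (λ eq → <⇒≢ x<y (arms-rotate-injective adm eq))
  (short-arm x<y (adm .centre≤k)) (full-arm k x y (m≤n⊔m x y)) (centreMarker-ρᴴ adm)
... | inj₂ refl | inj₂ refl =
  twin refl (full-arm k x x (m≤m⊔n x x)) (full-arm k x x (m≤m⊔n x x)) (centreMarker-ρᴴ adm)

markerSum-step : ∀ (Φ : ℕ → ℤ) {a b s a′ b′ s′} → a ≢ b → MarkerStep a b s a′ b′ s′ →
  Φ a′ ℤ.+ Φ b′ ℤ.+ Φ s′ ≡ Φ a ℤ.+ Φ b ℤ.+ Φ s
markerSum-step Φ _ (fixed refl refl refl) = refl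
markerSum-step Φ {a} {b} {s} _ (swapˡ _ refl refl refl) = xy∙z≈zy∙x (Φ s) (Φ b) (Φ a)
markerSum-step Φ {a} {b} {s} _ (swapʳ _ refl refl refl) = xy∙z≈xz∙y (Φ a) (Φ s) (Φ b)
markerSum-step Φ a≢b (twin a≡b _ _ _) = ⊥-elim (a≢b a≡b)

markerPair-step : ∀ {A : Set} (_∙_ : A → A → A) → (∀ p q → p ∙ q ≡ q ∙ p) → (Φ : ℕ → A) →
  ∀ {a b s a′ b′ s′} → a ≡ b → MarkerStep a b s a′ b′ s′ → Φ a′ ∙ Φ s′ ≡ Φ a ∙ Φ s
markerPair-step _∙_ comm Φ _ (fixed refl _ refl) = refl
markerPair-step _∙_ comm Φ a≡b (swapˡ a≢b _ _ _) = ⊥-elim (a≢b a≡b)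
markerPair-step _∙_ comm Φ a≡b (swapʳ a≢b _ _ _) = ⊥-elim (a≢b a≡b)
markerPair-step _∙_ comm Φ {a} {s = s} _ (twin _ refl _ refl) = comm (Φ s) (Φ a)

-- Potentials

N : ℕ → ℤ
N k = ℤ.+ suc (suc k)

-- The solution of φ m − φ (m + 1) = N · [j ≤ m] − (N − j) on the cycle ℤ/N: a rotating marker
-- lies in {j, …, N − 1} a fraction (N − j)/N of the time.
cyclePotential : ℕ → ℕ → ℕ → ℤ
cyclePotential k j m =
  if m ≤ᵇ j then (N k ℤ.- ℤ.+ j) ℤ.* ℤ.+ m else ℤ.+ j ℤ.* (N k ℤ.- ℤ.+ m)

cyclePotential-≤ : ∀ k {j m} → m ≤ j → cyclePotential k j m ≡ (N k ℤ.- ℤ.+ j) ℤ.* ℤ.+ m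
cyclePotential-≤ k m≤j rewrite ≤ᵇ-true m≤j = refl

cyclePotential-> : ∀ k {j m} → j < m → cyclePotential k j m ≡ ℤ.+ j ℤ.* (N k ℤ.- ℤ.+ m)
cyclePotential-> k j<m rewrite ≤ᵇ-false j<m = refl

cyclePotential-step : ∀ k j m → j ≤ k → m ≤ suc k →
  cyclePotential k j m ℤ.- cyclePotential k j (rotate k m)
    ≡ N k ℤ.* 𝟙 (j ≤ᵇ m) ℤ.- (N k ℤ.- ℤ.+ j)
cyclePotential-step k j m j≤k m≤1+k with m≤n⇒m<n∨m≡n m≤1+k
... | inj₂ refl rewrite rotate-top k | cyclePotential-> k (s≤s j≤k) | cyclePotential-≤ k (z≤n {j})
                      | 𝟙-≤ᵇ-true (m≤n⇒m≤1+n j≤k) = wrap (ℤ.+ j) (ℤ.+ k)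
  where
  wrap : ∀ J K →
    J ℤ.* ((ℤ.+ 2 ℤ.+ K) ℤ.- (ℤ.+ 1 ℤ.+ K)) ℤ.- ((ℤ.+ 2 ℤ.+ K) ℤ.- J) ℤ.* ℤ.+ 0
      ≡ (ℤ.+ 2 ℤ.+ K) ℤ.* ℤ.+ 1 ℤ.- ((ℤ.+ 2 ℤ.+ K) ℤ.- J)
  wrap = solve-∀
... | inj₁ (s≤s m≤k) with <-cmp m j
...   | tri< m<j _ _ rewrite rotate-≤ m≤k | cyclePotential-≤ k (<⇒≤ m<j) | cyclePotential-≤ k m<j
                           | 𝟙-≤ᵇ-false m<j = below (N k) (ℤ.+ j) (ℤ.+ m)
  where
  below : ∀ n J M →
    (n ℤ.- J) ℤ.* M ℤ.- (n ℤ.- J) ℤ.* (ℤ.+ 1 ℤ.+ M) ≡ n ℤ.* ℤ.+ 0 ℤ.- (n ℤ.- J)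
  below = solve-∀
...   | tri≈ _ refl _ rewrite rotate-≤ m≤k | cyclePotential-≤ k (≤-refl {m}) | cyclePotential-> k (n<1+n m)
                           | 𝟙-≤ᵇ-true (≤-refl {m}) = at (N k) (ℤ.+ m)
  where
  at : ∀ n J →
    (n ℤ.- J) ℤ.* J ℤ.- J ℤ.* (n ℤ.- (ℤ.+ 1 ℤ.+ J)) ≡ n ℤ.* ℤ.+ 1 ℤ.- (n ℤ.- J)
  at = solve-∀
...   | tri> _ _ j<m rewrite rotate-≤ m≤k | cyclePotential-> k j<m | cyclePotential-> k (m≤n⇒m≤1+n j<m)
                           | 𝟙-≤ᵇ-true (<⇒≤ j<m) = above (N k) (ℤ.+ j) (ℤ.+ m)
  where
  above : ∀ n J M →
    J ℤ.* (n ℤ.- M) ℤ.- J ℤ.* (n ℤ.- (ℤ.+ 1 ℤ.+ M)) ≡ n ℤ.* ℤ.+ 1 ℤ.- (n ℤ.- J)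
  above = solve-∀

centreAtMost : ℕ → ℕ → Heights → ℤ
centreAtMost k j t = 𝟙 (centreMarker k t ≤ᵇ j)

centreAtMost-step : ∀ {k} j t → Admissible k t →
  centreAtMost k j t ℤ.- centreAtMost k j (ρᴴ k t)
    ≡ 𝟙 (j ≤ᵇ height t c) ℤ.- 𝟙 (suc j ≤ᵇ centreMarker k t)
centreAtMost-step {k} j t adm = begin
  𝟙 (s ≤ᵇ j) ℤ.- 𝟙 (centreMarker k (ρᴴ k t) ≤ᵇ j)
    ≡⟨ cong (λ m → 𝟙 (s ≤ᵇ j) ℤ.- 𝟙 (m ≤ᵇ j))
            (trans (centreMarker-ρᴴ adm) (rotate-≤ (adm .centre≤k))) ⟩
  𝟙 (s ≤ᵇ j) ℤ.- 𝟙 (suc z ≤ᵇ j)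
    ≡⟨ cong (ℤ._-_ (𝟙 (s ≤ᵇ j))) (𝟙-complement j z) ⟩
  𝟙 (s ≤ᵇ j) ℤ.- (ℤ.+ 1 ℤ.- 𝟙 (j ≤ᵇ z))
    ≡⟨ swap (𝟙 (s ≤ᵇ j)) (𝟙 (j ≤ᵇ z)) ⟩
  𝟙 (j ≤ᵇ z) ℤ.- (ℤ.+ 1 ℤ.- 𝟙 (s ≤ᵇ j))
    ≡⟨ cong (ℤ._-_ (𝟙 (j ≤ᵇ z))) (𝟙-complement s j) ⟨
  𝟙 (j ≤ᵇ z) ℤ.- 𝟙 (suc j ≤ᵇ s) ∎
  where
  open ≡-Reasoning
  s = centreMarker k t
  z = height t c
  swap : ∀ a b → a ℤ.- (ℤ.+ 1 ℤ.- b) ≡ b ℤ.- (ℤ.+ 1 ℤ.- a)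
  swap = solve-∀

markerPotential : ℕ → ℕ → Heights → ℤ
markerPotential k j t@(x , y , z) = φ x ℤ.+ φ y ℤ.+ φ (centreMarker k t)
  where
  φ : ℕ → ℤ
  φ = cyclePotential k j

markerPotential-step : ∀ {k} j x y z → Admissible k (x , y , z) → j ≤ k → x ≢ y →
  markerPotential k j (x , y , z) ℤ.- markerPotential k j (ρᴴ k (x , y , z))
    ≡ N k ℤ.* (𝟙 (j ≤ᵇ x) ℤ.+ 𝟙 (j ≤ᵇ y) ℤ.+ 𝟙 (j ≤ᵇ centreMarker k (x , y , z)))
        ℤ.- ℤ.+ 3 ℤ.* (N k ℤ.- ℤ.+ j)
markerPotential-step {k} j x y z adm j≤k x≢y = begin
  (φ x ℤ.+ φ y ℤ.+ φ s)
    ℤ.- (φ (advance x z) ℤ.+ φ (advance y z) ℤ.+ φ (centreMarker k (ρᴴ k t)))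
    ≡⟨ cong (ℤ._-_ (φ x ℤ.+ φ y ℤ.+ φ s))
            (markerSum-step φ (x≢y ∘ arms-rotate-injective adm) (markerStep x y z adm)) ⟩
  (φ x ℤ.+ φ y ℤ.+ φ s) ℤ.- (φ (rotate k x) ℤ.+ φ (rotate k y) ℤ.+ φ (rotate k s))
    ≡⟨ regroup (φ x) (φ y) (φ s) (φ (rotate k x)) (φ (rotate k y)) (φ (rotate k s)) ⟩
  (φ x ℤ.- φ (rotate k x)) ℤ.+ (φ y ℤ.- φ (rotate k y)) ℤ.+ (φ s ℤ.- φ (rotate k s))
    ≡⟨ cong₂ ℤ._+_ (cong₂ ℤ._+_ (cyclePotential-step k j x j≤k (m≤n⇒m≤1+n (height≤k adm ℓ)))
                                (cyclePotential-step k j y j≤k (m≤n⇒m≤1+n (height≤k adm r))))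
                   (cyclePotential-step k j s j≤k (centreMarker≤ adm)) ⟩
  (n ℤ.* 𝟙 (j ≤ᵇ x) ℤ.- (n ℤ.- ℤ.+ j)) ℤ.+ (n ℤ.* 𝟙 (j ≤ᵇ y) ℤ.- (n ℤ.- ℤ.+ j))
    ℤ.+ (n ℤ.* 𝟙 (j ≤ᵇ s) ℤ.- (n ℤ.- ℤ.+ j))
    ≡⟨ collect n (ℤ.+ j) (𝟙 (j ≤ᵇ x)) (𝟙 (j ≤ᵇ y)) (𝟙 (j ≤ᵇ s)) ⟩
  n ℤ.* (𝟙 (j ≤ᵇ x) ℤ.+ 𝟙 (j ≤ᵇ y) ℤ.+ 𝟙 (j ≤ᵇ s)) ℤ.- ℤ.+ 3 ℤ.* (n ℤ.- ℤ.+ j) ∎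
  where
  open ≡-Reasoning
  n = N k
  t = (x , y , z)
  s = centreMarker k t
  φ : ℕ → ℤ
  φ = cyclePotential k j
  regroup : ∀ a b c a′ b′ c′ →
    (a ℤ.+ b ℤ.+ c) ℤ.- (a′ ℤ.+ b′ ℤ.+ c′) ≡ (a ℤ.- a′) ℤ.+ (b ℤ.- b′) ℤ.+ (c ℤ.- c′)
  regroup = solve-∀
  collect : ∀ n J X Y S →
    (n ℤ.* X ℤ.- (n ℤ.- J)) ℤ.+ (n ℤ.* Y ℤ.- (n ℤ.- J)) ℤ.+ (n ℤ.* S ℤ.- (n ℤ.- J))
      ≡ n ℤ.* (X ℤ.+ Y ℤ.+ S) ℤ.- ℤ.+ 3 ℤ.* (n ℤ.- J)
  collect = solve-∀

asymmetricPotential : ℕ → ℕ → Heights → ℤ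
asymmetricPotential k j₀ t = markerPotential k (suc j₀) t ℤ.+ N k ℤ.* centreAtMost k j₀ t

asymmetricPotential-step : ∀ {k} j₀ x y z → Admissible k (x , y , z) → suc j₀ ≤ k → x ≢ y →
  asymmetricPotential k j₀ (x , y , z) ℤ.- asymmetricPotential k j₀ (ρᴴ k (x , y , z))
    ≡ N k ℤ.* Fᴴ (suc j₀) (x , y , z) ℤ.- ℤ.+ 3 ℤ.* (N k ℤ.- ℤ.+ suc j₀)
asymmetricPotential-step {k} j₀ x y z adm j≤k x≢y = begin
  (M t ℤ.+ n ℤ.* Ψ t) ℤ.- (M t′ ℤ.+ n ℤ.* Ψ t′)
    ≡⟨ regroup (M t) (Ψ t) (M t′) (Ψ t′) n ⟩
  (M t ℤ.- M t′) ℤ.+ n ℤ.* (Ψ t ℤ.- Ψ t′)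
    ≡⟨ cong₂ ℤ._+_ (markerPotential-step j x y z adm j≤k x≢y)
                   (cong (n ℤ.*_) (centreAtMost-step j₀ t adm)) ⟩
  (n ℤ.* (X ℤ.+ Y ℤ.+ S) ℤ.- ℤ.+ 3 ℤ.* (n ℤ.- ℤ.+ j)) ℤ.+ n ℤ.* (Z ℤ.- S)
    ≡⟨ collect n (ℤ.+ j) X Y S Z ⟩
  n ℤ.* (X ℤ.+ Y ℤ.+ Z) ℤ.- ℤ.+ 3 ℤ.* (n ℤ.- ℤ.+ j) ∎
  where
  open ≡-Reasoning
  j = suc j₀
  n = N k
  t = (x , y , z)
  t′ = ρᴴ k t
  M Ψ : Heights → ℤ
  M = markerPotential k j
  Ψ = centreAtMost k j₀
  X = 𝟙 (j ≤ᵇ x)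
  Y = 𝟙 (j ≤ᵇ y)
  S = 𝟙 (j ≤ᵇ centreMarker k t)
  Z = 𝟙 (j₀ ≤ᵇ z)
  regroup : ∀ a b a′ b′ n →
    (a ℤ.+ n ℤ.* b) ℤ.- (a′ ℤ.+ n ℤ.* b′) ≡ (a ℤ.- a′) ℤ.+ n ℤ.* (b ℤ.- b′)
  regroup = solve-∀
  collect : ∀ n J X Y S Z →
    (n ℤ.* (X ℤ.+ Y ℤ.+ S) ℤ.- ℤ.+ 3 ℤ.* (n ℤ.- J)) ℤ.+ n ℤ.* (Z ℤ.- S)
      ≡ n ℤ.* (X ℤ.+ Y ℤ.+ Z) ℤ.- ℤ.+ 3 ℤ.* (n ℤ.- J)
  collect = solve-∀

pairPotential : ℕ → ℕ → Heights → ℤ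
pairPotential k j t@(x , y , z) = cyclePotential k j x ℤ.+ cyclePotential k j (centreMarker k t)

pairPotential-step : ∀ {k} j x z → Admissible k (x , x , z) → j ≤ k →
  pairPotential k j (x , x , z) ℤ.- pairPotential k j (ρᴴ k (x , x , z))
    ≡ N k ℤ.* (𝟙 (j ≤ᵇ x) ℤ.+ 𝟙 (j ≤ᵇ centreMarker k (x , x , z)))
        ℤ.- ℤ.+ 2 ℤ.* (N k ℤ.- ℤ.+ j)
pairPotential-step {k} j x z adm j≤k = begin
  (φ x ℤ.+ φ s) ℤ.- (φ (advance x z) ℤ.+ φ s′)
    ≡⟨ cong (ℤ._-_ (φ x ℤ.+ φ s))
            (markerPair-step ℤ._+_ ℤ.+-comm φ refl (markerStep x x z adm)) ⟩
  (φ x ℤ.+ φ s) ℤ.- (φ (rotate k x) ℤ.+ φ (rotate k s))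
    ≡⟨ regroup (φ x) (φ s) (φ (rotate k x)) (φ (rotate k s)) ⟩
  (φ x ℤ.- φ (rotate k x)) ℤ.+ (φ s ℤ.- φ (rotate k s))
    ≡⟨ cong₂ ℤ._+_ (cyclePotential-step k j x j≤k (m≤n⇒m≤1+n (height≤k adm ℓ)))
                   (cyclePotential-step k j s j≤k (centreMarker≤ adm)) ⟩
  (n ℤ.* 𝟙 (j ≤ᵇ x) ℤ.- (n ℤ.- ℤ.+ j)) ℤ.+ (n ℤ.* 𝟙 (j ≤ᵇ s) ℤ.- (n ℤ.- ℤ.+ j))
    ≡⟨ collect n (ℤ.+ j) (𝟙 (j ≤ᵇ x)) (𝟙 (j ≤ᵇ s)) ⟩
  n ℤ.* (𝟙 (j ≤ᵇ x) ℤ.+ 𝟙 (j ≤ᵇ s)) ℤ.- ℤ.+ 2 ℤ.* (n ℤ.- ℤ.+ j) ∎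
  where
  open ≡-Reasoning
  n = N k
  s = centreMarker k (x , x , z)
  s′ = centreMarker k (ρᴴ k (x , x , z))
  φ : ℕ → ℤ
  φ = cyclePotential k j
  regroup : ∀ a c a′ c′ → (a ℤ.+ c) ℤ.- (a′ ℤ.+ c′) ≡ (a ℤ.- a′) ℤ.+ (c ℤ.- c′)
  regroup = solve-∀
  collect : ∀ n J X S →
    (n ℤ.* X ℤ.- (n ℤ.- J)) ℤ.+ (n ℤ.* S ℤ.- (n ℤ.- J)) ≡ n ℤ.* (X ℤ.+ S) ℤ.- ℤ.+ 2 ℤ.* (n ℤ.- J)
  collect = solve-∀

suc-≤ᵇ-suc : ∀ a b → (suc a ≤ᵇ suc b) ≡ (a ≤ᵇ b)
suc-≤ᵇ-suc zero    b = refl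
suc-≤ᵇ-suc (suc a) b = refl

inWindow : ℕ → ℕ → ℕ → Bool
inWindow w s₀ m = (s₀ ≤ᵇ m) ∧ (suc m ≤ᵇ s₀ + w)

inWindow-rotate : ∀ k i w s₀ m → i + w ≡ suc (suc k) → s₀ < i → m ≤ suc k →
  inWindow w (suc s₀) (rotate k m) ≡ inWindow w s₀ m
inWindow-rotate k i w s₀ m i+w≡N s₀<i m≤1+k with m≤n⇒m<n∨m≡n m≤1+k
... | inj₁ (s≤s m≤k) rewrite rotate-≤ m≤k =
  cong₂ _∧_ (suc-≤ᵇ-suc s₀ m) (suc-≤ᵇ-suc (suc m) (s₀ + w))
... | inj₂ refl rewrite rotate-top k
  | ≤ᵇ-false {suc (suc k)} {s₀ + w} (subst (s₀ + w <_) i+w≡N (+-monoˡ-< w s₀<i)) =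
  sym (∧-zeroʳ (s₀ ≤ᵇ suc k))

≤ᵇ-∧-upper : ∀ i {a b} → a ≤ b → ((i ≤ᵇ a) ∧ (i ≤ᵇ b)) ≡ (i ≤ᵇ a)
≤ᵇ-∧-upper i {a} a≤b with i ≤? a
... | yes i≤a rewrite ≤ᵇ-true i≤a | ≤ᵇ-true (≤-trans i≤a a≤b) = refl
... | no i≰a rewrite ≤ᵇ-false (≰⇒> i≰a) = refl

≤ᵇ-∧-lower : ∀ w {a b} → a ≤ b → ((a ≤ᵇ w) ∧ (b ≤ᵇ w)) ≡ (b ≤ᵇ w)
≤ᵇ-∧-lower w {a} {b} a≤b with b ≤? w
... | yes b≤w rewrite ≤ᵇ-true b≤w | ≤ᵇ-true (≤-trans a≤b b≤w) = refl
... | no b≰w rewrite ≤ᵇ-false (≰⇒> b≰w) = ∧-zeroʳ (a ≤ᵇ w)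

inWindow-top : ∀ k i w m → i + w ≡ suc (suc k) → m ≤ suc k → inWindow w i m ≡ (i ≤ᵇ m)
inWindow-top k i w m i+w≡N m≤1+k rewrite ≤ᵇ-true (subst (suc m ≤_) (sym i+w≡N) (s≤s m≤1+k)) =
  ∧-identityʳ (i ≤ᵇ m)

windowIndicator : ℕ → ℕ → ℕ → Heights → ℤ
windowIndicator k w s₀ t@(x , y , z) = 𝟙 (inWindow w s₀ x ∧ inWindow w s₀ (centreMarker k t))

windowIndicator-step : ∀ {k} i w s₀ x z → Admissible k (x , x , z) →
  i + w ≡ suc (suc k) → s₀ < i →
  windowIndicator k w (suc s₀) (ρᴴ k (x , x , z)) ≡ windowIndicator k w s₀ (x , x , z)
windowIndicator-step {k} i w s₀ x z adm i+w≡N s₀<i = cong 𝟙 (begin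
  inWindow w (suc s₀) (advance x z) ∧ inWindow w (suc s₀) (centreMarker k (ρᴴ k (x , x , z)))
    ≡⟨ markerPair-step _∧_ ∧-comm (inWindow w (suc s₀)) refl (markerStep x x z adm) ⟩
  inWindow w (suc s₀) (rotate k x) ∧ inWindow w (suc s₀) (rotate k (centreMarker k (x , x , z)))
    ≡⟨ cong₂ _∧_ (inWindow-rotate k i w s₀ x i+w≡N s₀<i (m≤n⇒m≤1+n (height≤k adm ℓ)))
                 (inWindow-rotate k i w s₀ _ i+w≡N s₀<i (centreMarker≤ adm)) ⟩
  inWindow w s₀ x ∧ inWindow w s₀ (centreMarker k (x , x , z)) ∎)
  where open ≡-Reasoning

windowIndicator-top : ∀ {k} i w x z → Admissible k (x , x , z) → i + w ≡ suc (suc k) →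
  windowIndicator k w i (x , x , z) ≡ 𝟙 (i ≤ᵇ x)
windowIndicator-top {k} i w x z adm i+w≡N = cong 𝟙 (begin
  inWindow w i x ∧ inWindow w i s
    ≡⟨ cong₂ _∧_ (inWindow-top k i w x i+w≡N (m≤n⇒m≤1+n (height≤k adm ℓ)))
                 (inWindow-top k i w s i+w≡N (centreMarker≤ adm)) ⟩
  (i ≤ᵇ x) ∧ (i ≤ᵇ s)
    ≡⟨ ≤ᵇ-∧-upper i (arm≤centreMarker adm ℓ) ⟩
  i ≤ᵇ x ∎)
  where
  open ≡-Reasoning
  s = centreMarker k (x , x , z)

windowIndicator-bottom : ∀ {k} w x z → Admissible k (x , x , z) →
  windowIndicator k w 0 (x , x , z) ≡ ℤ.+ 1 ℤ.- 𝟙 (w ≤ᵇ centreMarker k (x , x , z))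
windowIndicator-bottom {k} w x z adm =
  trans (cong 𝟙 (≤ᵇ-∧-lower w (s≤s (arm≤centreMarker adm ℓ))))
        (𝟙-complement w (centreMarker k (x , x , z)))

-- For x = y the marker x is always the smaller of the pair {x , s}, so 𝟙 (i ≤ᵇ x) is not a
-- symmetric function of the markers; counting the windows [s₀ , s₀ + w), 1 ≤ s₀ ≤ i, that contain
-- both markers gives a potential for it.
windowPotential : ℕ → ℕ → ℕ → Heights → ℤ
windowPotential k w zero    t = ℤ.+ 0
windowPotential k w (suc n) t = windowPotential k w n t ℤ.+ windowIndicator k w (suc n) t

windowPotential-telescope : ∀ {k} i w n x z → Admissible k (x , x , z) →
  i + w ≡ suc (suc k) → n ≤ i →
  windowPotential k w n (x , x , z) ℤ.- windowPotential k w n (ρᴴ k (x , x , z))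
    ≡ windowIndicator k w n (x , x , z) ℤ.- windowIndicator k w 0 (x , x , z)
windowPotential-telescope {k} i w zero x z adm i+w≡N _ =
  sym (ℤ.+-inverseʳ (windowIndicator k w 0 (x , x , z)))
windowPotential-telescope {k} i w (suc n) x z adm i+w≡N n<i = begin
  (W n t ℤ.+ σ (suc n) t) ℤ.- (W n t′ ℤ.+ σ (suc n) t′)
    ≡⟨ cong (λ u → (W n t ℤ.+ σ (suc n) t) ℤ.- (W n t′ ℤ.+ u))
            (windowIndicator-step i w n x z adm i+w≡N n<i) ⟩
  (W n t ℤ.+ σ (suc n) t) ℤ.- (W n t′ ℤ.+ σ n t)
    ≡⟨ regroup (W n t) (W n t′) (σ (suc n) t) (σ n t) ⟩
  (W n t ℤ.- W n t′) ℤ.+ (σ (suc n) t ℤ.- σ n t)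
    ≡⟨ cong (ℤ._+ (σ (suc n) t ℤ.- σ n t))
            (windowPotential-telescope i w n x z adm i+w≡N (<⇒≤ n<i)) ⟩
  (σ n t ℤ.- σ 0 t) ℤ.+ (σ (suc n) t ℤ.- σ n t)
    ≡⟨ cancel (σ n t) (σ 0 t) (σ (suc n) t) ⟩
  σ (suc n) t ℤ.- σ 0 t ∎
  where
  open ≡-Reasoning
  t = (x , x , z)
  t′ = ρᴴ k t
  W : ℕ → Heights → ℤ
  W = windowPotential k w
  σ : ℕ → Heights → ℤ
  σ = windowIndicator k w
  regroup : ∀ a a′ b c → (a ℤ.+ b) ℤ.- (a′ ℤ.+ c) ≡ (a ℤ.- a′) ℤ.+ (b ℤ.- c)
  regroup = solve-∀
  cancel : ∀ a b c → (a ℤ.- b) ℤ.+ (c ℤ.- a) ≡ c ℤ.- b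
  cancel = solve-∀

windowPotential-step : ∀ {k} i w x z → Admissible k (x , x , z) → i + w ≡ suc (suc k) →
  windowPotential k w i (x , x , z) ℤ.- windowPotential k w i (ρᴴ k (x , x , z))
    ≡ 𝟙 (i ≤ᵇ x) ℤ.- (ℤ.+ 1 ℤ.- 𝟙 (w ≤ᵇ centreMarker k (x , x , z)))
windowPotential-step i w x z adm i+w≡N =
  trans (windowPotential-telescope i w i x z adm i+w≡N ≤-refl)
        (cong₂ ℤ._-_ (windowIndicator-top i w x z adm i+w≡N) (windowIndicator-bottom w x z adm))

symmetricPotential : ℕ → ℕ → ℕ → Heights → ℤ
symmetricPotential k i₀ i₀′ t =
  pairPotential k (suc i₀) t ℤ.- ℤ.+ 2 ℤ.* pairPotential k (suc i₀′) t
    ℤ.+ N k ℤ.* (windowPotential k (suc i₀′) (suc i₀) t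
                 ℤ.+ centreAtMost k i₀ t ℤ.- centreAtMost k i₀′ t)

-- A ring identity; its last term vanishes when n = I + I′.
symmetric-collect : ∀ n I I′ X S X′ S′ Z Z′ →
  (n ℤ.* (X ℤ.+ S) ℤ.- ℤ.+ 2 ℤ.* (n ℤ.- I))
    ℤ.- ℤ.+ 2 ℤ.* (n ℤ.* (X′ ℤ.+ S′) ℤ.- ℤ.+ 2 ℤ.* (n ℤ.- I′))
    ℤ.+ n ℤ.* ((X ℤ.- (ℤ.+ 1 ℤ.- S′)) ℤ.+ (Z ℤ.- S) ℤ.- (Z′ ℤ.- S′))
  ≡ n ℤ.* ((X ℤ.+ X ℤ.+ Z) ℤ.- (X′ ℤ.+ X′ ℤ.+ Z′)) ℤ.- ℤ.+ 3 ℤ.* (I′ ℤ.- I)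
    ℤ.+ (n ℤ.- (I ℤ.+ I′))
symmetric-collect = solve-∀

symmetricPotential-step : ∀ {k} i₀ i₀′ x z → Admissible k (x , x , z) →
  suc i₀ ≤ k → suc i₀′ ≤ k → suc i₀ + suc i₀′ ≡ suc (suc k) →
  symmetricPotential k i₀ i₀′ (x , x , z) ℤ.- symmetricPotential k i₀ i₀′ (ρᴴ k (x , x , z))
    ≡ N k ℤ.* (Fᴴ (suc i₀) (x , x , z) ℤ.- Fᴴ (suc i₀′) (x , x , z))
        ℤ.- ℤ.+ 3 ℤ.* (ℤ.+ suc i₀′ ℤ.- ℤ.+ suc i₀)
symmetricPotential-step {k} i₀ i₀′ x z adm i≤k i′≤k i+i′≡N = begin
  (P i t ℤ.- ℤ.+ 2 ℤ.* P i′ t ℤ.+ n ℤ.* (W t ℤ.+ Ψ i₀ t ℤ.- Ψ i₀′ t))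
    ℤ.- (P i t′ ℤ.- ℤ.+ 2 ℤ.* P i′ t′ ℤ.+ n ℤ.* (W t′ ℤ.+ Ψ i₀ t′ ℤ.- Ψ i₀′ t′))
    ≡⟨ regroup (P i t) (P i′ t) (W t) (Ψ i₀ t) (Ψ i₀′ t)
               (P i t′) (P i′ t′) (W t′) (Ψ i₀ t′) (Ψ i₀′ t′) n ⟩
  (P i t ℤ.- P i t′) ℤ.- ℤ.+ 2 ℤ.* (P i′ t ℤ.- P i′ t′)
    ℤ.+ n ℤ.* ((W t ℤ.- W t′) ℤ.+ (Ψ i₀ t ℤ.- Ψ i₀ t′) ℤ.- (Ψ i₀′ t ℤ.- Ψ i₀′ t′))
    ≡⟨ cong₂ ℤ._+_ (cong₂ ℤ._-_ (pairPotential-step i x z adm i≤k)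
                                (cong (ℤ.+ 2 ℤ.*_) (pairPotential-step i′ x z adm i′≤k)))
                   (cong (n ℤ.*_) (cong₂ ℤ._-_ (cong₂ ℤ._+_ (windowPotential-step i i′ x z adm i+i′≡N)
                                                            (centreAtMost-step i₀ t adm))
                                               (centreAtMost-step i₀′ t adm))) ⟩
  (n ℤ.* (X i ℤ.+ S i) ℤ.- ℤ.+ 2 ℤ.* (n ℤ.- I))
    ℤ.- ℤ.+ 2 ℤ.* (n ℤ.* (X i′ ℤ.+ S i′) ℤ.- ℤ.+ 2 ℤ.* (n ℤ.- I′))
    ℤ.+ n ℤ.* ((X i ℤ.- (ℤ.+ 1 ℤ.- S i′)) ℤ.+ (Z i₀ ℤ.- S i) ℤ.- (Z i₀′ ℤ.- S i′))
    ≡⟨ symmetric-collect n I I′ (X i) (S i) (X i′) (S i′) (Z i₀) (Z i₀′) ⟩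
  R ℤ.+ (n ℤ.- (I ℤ.+ I′))
    ≡⟨ cong (ℤ._+_ R) (ℤ.i≡j⇒i-j≡0 (cong ℤ.+_ (sym i+i′≡N))) ⟩
  R ℤ.+ ℤ.+ 0
    ≡⟨ ℤ.+-identityʳ R ⟩
  R ∎
  where
  open ≡-Reasoning
  i = suc i₀
  i′ = suc i₀′
  I = ℤ.+ i
  I′ = ℤ.+ i′
  n = N k
  t = (x , x , z)
  t′ = ρᴴ k t
  P : ℕ → Heights → ℤ
  P = pairPotential k
  W : Heights → ℤ
  W = windowPotential k i′ i
  Ψ : ℕ → Heights → ℤ
  Ψ = centreAtMost k
  X S Z : ℕ → ℤ
  X j = 𝟙 (j ≤ᵇ x)
  S j = 𝟙 (j ≤ᵇ centreMarker k t)
  Z j = 𝟙 (j ≤ᵇ z)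
  R = n ℤ.* ((X i ℤ.+ X i ℤ.+ Z i₀) ℤ.- (X i′ ℤ.+ X i′ ℤ.+ Z i₀′))
        ℤ.- ℤ.+ 3 ℤ.* (I′ ℤ.- I)
  regroup : ∀ a b w p q a′ b′ w′ p′ q′ n →
    (a ℤ.- ℤ.+ 2 ℤ.* b ℤ.+ n ℤ.* (w ℤ.+ p ℤ.- q))
      ℤ.- (a′ ℤ.- ℤ.+ 2 ℤ.* b′ ℤ.+ n ℤ.* (w′ ℤ.+ p′ ℤ.- q′))
    ≡ (a ℤ.- a′) ℤ.- ℤ.+ 2 ℤ.* (b ℤ.- b′)
      ℤ.+ n ℤ.* ((w ℤ.- w′) ℤ.+ (p ℤ.- p′) ℤ.- (q ℤ.- q′))
  regroup = solve-∀

-- Rowmotion preserves whether x = y, so each step of the potential stays within one branch.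
potential : ℕ → ℕ → ℕ → Heights → ℤ
potential k i₀ i₀′ t@(x , y , z) =
  if x ≡ᵇ y then symmetricPotential k i₀ i₀′ t
  else asymmetricPotential k i₀ t ℤ.- asymmetricPotential k i₀′ t

potential-step : ∀ {k} i₀ i₀′ t → Admissible k t →
  suc i₀ ≤ k → suc i₀′ ≤ k → suc i₀ + suc i₀′ ≡ suc (suc k) →
  potential k i₀ i₀′ t ℤ.- potential k i₀ i₀′ (ρᴴ k t)
    ≡ N k ℤ.* (Fᴴ (suc i₀) t ℤ.- Fᴴ (suc i₀′) t) ℤ.- ℤ.+ 3 ℤ.* (ℤ.+ suc i₀′ ℤ.- ℤ.+ suc i₀)
potential-step {k} i₀ i₀′ (x , y , z) adm i≤k i′≤k i+i′≡N with x ≟ y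
... | yes refl rewrite ≡ᵇ-refl x | ≡ᵇ-refl (advance x z) =
  symmetricPotential-step i₀ i₀′ x z adm i≤k i′≤k i+i′≡N
... | no x≢y
  rewrite ≡ᵇ-false x≢y | ≡ᵇ-false (x≢y ∘ advance-injective (adm .arm≤centre ℓ) (adm .arm≤centre r)) =
  begin
  (G i₀ t ℤ.- G i₀′ t) ℤ.- (G i₀ t′ ℤ.- G i₀′ t′)
    ≡⟨ regroup (G i₀ t) (G i₀′ t) (G i₀ t′) (G i₀′ t′) ⟩
  (G i₀ t ℤ.- G i₀ t′) ℤ.- (G i₀′ t ℤ.- G i₀′ t′)
    ≡⟨ cong₂ ℤ._-_ (asymmetricPotential-step i₀ x y z adm i≤k x≢y)
                   (asymmetricPotential-step i₀′ x y z adm i′≤k x≢y) ⟩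
  (n ℤ.* Fᴴ (suc i₀) t ℤ.- ℤ.+ 3 ℤ.* (n ℤ.- ℤ.+ suc i₀))
    ℤ.- (n ℤ.* Fᴴ (suc i₀′) t ℤ.- ℤ.+ 3 ℤ.* (n ℤ.- ℤ.+ suc i₀′))
    ≡⟨ collect n (ℤ.+ suc i₀) (ℤ.+ suc i₀′) (Fᴴ (suc i₀) t) (Fᴴ (suc i₀′) t) ⟩
  n ℤ.* (Fᴴ (suc i₀) t ℤ.- Fᴴ (suc i₀′) t) ℤ.- ℤ.+ 3 ℤ.* (ℤ.+ suc i₀′ ℤ.- ℤ.+ suc i₀) ∎
  where
  open ≡-Reasoning
  n = N k
  t = (x , y , z)
  t′ = ρᴴ k t
  G : ℕ → Heights → ℤ
  G = asymmetricPotential k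
  regroup : ∀ a b a′ b′ → (a ℤ.- b) ℤ.- (a′ ℤ.- b′) ≡ (a ℤ.- a′) ℤ.- (b ℤ.- b′)
  regroup = solve-∀
  collect : ∀ n I I′ F F′ →
    (n ℤ.* F ℤ.- ℤ.+ 3 ℤ.* (n ℤ.- I)) ℤ.- (n ℤ.* F′ ℤ.- ℤ.+ 3 ℤ.* (n ℤ.- I′))
      ≡ n ℤ.* (F ℤ.- F′) ℤ.- ℤ.+ 3 ℤ.* (I′ ℤ.- I)
  collect = solve-∀

-- Orbit sums

sumUpTo : (ℕ → ℤ) → ℕ → ℤ
sumUpTo f n = foldr (λ j acc → f j ℤ.+ acc) (ℤ.+ 0) (upTo n)

sumUpTo-suc : ∀ f n → sumUpTo f (suc n) ≡ f 0 ℤ.+ sumUpTo (f ∘ suc) n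
sumUpTo-suc f n =
  cong (ℤ._+_ (f 0)) (trans (cong (foldr _ _) (sym (map-upTo suc n))) (foldr-map _ suc _ (upTo n)))

sumUpTo-cong : ∀ {f g} n → (∀ j → f j ≡ g j) → sumUpTo f n ≡ sumUpTo g n
sumUpTo-cong {f} {g} n f≗g = begin
  foldr (λ j acc → f j ℤ.+ acc) (ℤ.+ 0) (upTo n) ≡⟨ foldr-map ℤ._+_ f _ (upTo n) ⟨
  foldr ℤ._+_ (ℤ.+ 0) (map f (upTo n))           ≡⟨ cong (foldr ℤ._+_ (ℤ.+ 0)) (map-cong f≗g (upTo n)) ⟩
  foldr ℤ._+_ (ℤ.+ 0) (map g (upTo n))           ≡⟨ foldr-map ℤ._+_ g _ (upTo n) ⟩
  foldr (λ j acc → g j ℤ.+ acc) (ℤ.+ 0) (upTo n) ∎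
  where open ≡-Reasoning

telescope : ∀ (M C : ℤ) (g h : ℕ → ℤ) n → (∀ j → h j ℤ.- h (suc j) ≡ M ℤ.* g j ℤ.- C) →
  M ℤ.* sumUpTo g n ≡ h 0 ℤ.- h n ℤ.+ ℤ.+ n ℤ.* C
telescope M C g h zero _ = empty M (h 0) C
  where
  empty : ∀ M a C → M ℤ.* ℤ.+ 0 ≡ a ℤ.- a ℤ.+ ℤ.+ 0 ℤ.* C
  empty = solve-∀
telescope M C g h (suc n) step = begin
  M ℤ.* sumUpTo g (suc n)
    ≡⟨ cong (M ℤ.*_) (sumUpTo-suc g n) ⟩
  M ℤ.* (g 0 ℤ.+ sumUpTo (g ∘ suc) n)
    ≡⟨ ℤ.*-distribˡ-+ M (g 0) _ ⟩
  M ℤ.* g 0 ℤ.+ M ℤ.* sumUpTo (g ∘ suc) n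
    ≡⟨ cong₂ ℤ._+_ (isolate (h 0 ℤ.- h 1) (M ℤ.* g 0) (step 0))
                   (telescope M C (g ∘ suc) (h ∘ suc) n (step ∘ suc)) ⟩
  (h 0 ℤ.- h 1 ℤ.+ C) ℤ.+ (h 1 ℤ.- h (suc n) ℤ.+ ℤ.+ n ℤ.* C)
    ≡⟨ merge (h 0) (h 1) (h (suc n)) C (ℤ.+ n) ⟩
  h 0 ℤ.- h (suc n) ℤ.+ ℤ.+ suc n ℤ.* C ∎
  where
  open ≡-Reasoning
  isolate : ∀ a b → a ≡ b ℤ.- C → b ≡ a ℤ.+ C
  isolate .(b ℤ.- C) b refl = sym (cancel b C)
    where
    cancel : ∀ b C → b ℤ.- C ℤ.+ C ≡ b
    cancel = solve-∀
  merge : ∀ a b c C m →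
    (a ℤ.- b ℤ.+ C) ℤ.+ (b ℤ.- c ℤ.+ m ℤ.* C) ≡ a ℤ.- c ℤ.+ (ℤ.+ 1 ℤ.+ m) ℤ.* C
  merge = solve-∀

orbitSum-coboundary : ∀ {k} i i′ → 2 ≤ i → 2 ≤ i′ → i ≤ k → i′ ≤ k → i + i′ ≡ suc (suc k) →
  ∀ (I : Subset k) → IsOrderIdeal I → ∀ p → iter p ρ I ≐ I →
  N k ℤ.* orbitSum (λ J → F i J ℤ.- F i′ J) I p ≡ ℤ.+ p ℤ.* (ℤ.+ 3 ℤ.* (ℤ.+ i′ ℤ.- ℤ.+ i))
orbitSum-coboundary {k} i@(suc i₀) i′@(suc i₀′) 2≤i 2≤i′ i≤k i′≤k i+i′≡N I isIdeal p periodic =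
  begin
  N k ℤ.* orbitSum (λ J → F i J ℤ.- F i′ J) I p
    ≡⟨ cong (N k ℤ.*_) (sumUpTo-cong p statistic-heights) ⟩
  N k ℤ.* sumUpTo (λ j → Fᴴ i (t j) ℤ.- Fᴴ i′ (t j)) p
    ≡⟨ telescope (N k) C (λ j → Fᴴ i (t j) ℤ.- Fᴴ i′ (t j)) (H ∘ t) p
                 (λ j → potential-step i₀ i₀′ (t j) (admissible-iter adm j) i≤k i′≤k i+i′≡N) ⟩
  H (t 0) ℤ.- H (t p) ℤ.+ ℤ.+ p ℤ.* C
    ≡⟨ cong (λ u → H (t 0) ℤ.- H u ℤ.+ ℤ.+ p ℤ.* C) t-periodic ⟩
  H (t 0) ℤ.- H (t 0) ℤ.+ ℤ.+ p ℤ.* C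
    ≡⟨ cancel (H (t 0)) (ℤ.+ p ℤ.* C) ⟩
  ℤ.+ p ℤ.* C ∎
  where
  open ≡-Reasoning
  C = ℤ.+ 3 ℤ.* (ℤ.+ i′ ℤ.- ℤ.+ i)
  H : Heights → ℤ
  H = potential k i₀ i₀′
  adm : Admissible k (heights I)
  adm = admissible-heights I isIdeal
  t : ℕ → Heights
  t j = iter j (ρᴴ k) (heights I)
  Iₙ≐tₙ : ∀ j → iter j ρ I ≐ ideal (t j)
  Iₙ≐tₙ = iter-ideal I adm (ideal-heights I isIdeal)
  statistic-heights : ∀ j → F i (iter j ρ I) ℤ.- F i′ (iter j ρ I) ≡ Fᴴ i (t j) ℤ.- Fᴴ i′ (t j)
  statistic-heights j = cong₂ ℤ._-_
    (trans (F-cong i (Iₙ≐tₙ j)) (F-ideal i 2≤i (admissible-iter adm j)))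
    (trans (F-cong i′ (Iₙ≐tₙ j)) (F-ideal i′ 2≤i′ (admissible-iter adm j)))
  t-periodic : t p ≡ t 0
  t-periodic = begin
    t p                       ≡⟨ heights-ideal (admissible-iter adm p) ⟨
    heights (ideal {k} (t p)) ≡⟨ heights-cong (λ e → sym (Iₙ≐tₙ p e)) ⟩
    heights (iter p ρ I)      ≡⟨ heights-cong periodic ⟩
    heights I                 ∎
  cancel : ∀ a b → a ℤ.- a ℤ.+ b ≡ b
  cancel = solve-∀

-- By definition a / suc m is fromℚᵘ (mkℚᵘ a m).
/-cross : ∀ a b m n → a ℤ.* ℤ.+ suc n ≡ b ℤ.* ℤ.+ suc m → a / suc m ≡ b / suc n
/-cross a b m n eq = ℚ.fromℚᵘ-cong {ℚᵘ.mkℚᵘ a m} {ℚᵘ.mkℚᵘ b n} (ℚᵘ.*≡* eq)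

complement-bounds : ∀ {k i} → 2 ≤ i → i ≤ k →
  2 ≤ k + 2 ∸ i × k + 2 ∸ i ≤ k × i + (k + 2 ∸ i) ≡ suc (suc k)
complement-bounds {k} {i} 2≤i i≤k =
  subst (2 ≤_) (sym (+-∸-comm 2 i≤k)) (m≤n+m 2 (k ∸ i)) ,
  subst (k + 2 ∸ i ≤_) (m+n∸n≡m k 2) (∸-monoʳ-≤ (k + 2) 2≤i) ,
  trans (m+[n∸m]≡n (≤-trans i≤k (m≤m+n k 2))) (+-comm k 2)

complement-difference : ∀ {k} i i′ → i + i′ ≡ suc (suc k) →
  ℤ.+ (k + 2) ℤ.- ℤ.+ (2 * i) ≡ ℤ.+ i′ ℤ.- ℤ.+ i
complement-difference {k} i i′ i+i′≡N = begin
  ℤ.+ (k + 2) ℤ.- ℤ.+ (2 * i)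
    ≡⟨ cong₂ (λ a b → ℤ.+ a ℤ.- ℤ.+ b) (trans (+-comm k 2) (sym i+i′≡N))
                                        (cong (i +_) (+-identityʳ i)) ⟩
  (ℤ.+ i ℤ.+ ℤ.+ i′) ℤ.- (ℤ.+ i ℤ.+ ℤ.+ i)
    ≡⟨ cancel (ℤ.+ i) (ℤ.+ i′) ⟩
  ℤ.+ i′ ℤ.- ℤ.+ i ∎
  where
  open ≡-Reasoning
  cancel : ∀ a b → (a ℤ.+ b) ℤ.- (a ℤ.+ a) ≡ b ℤ.- a
  cancel = solve-∀

-- The hypothesis 1 < k is implied by 2 ≤ i ≤ k.
theorem3p20 : ∀ (k : ℕ) → 1 < k → ∀ (i : ℕ) → 2 ≤ i → i ≤ k →
    IsMesic k (λ I → F i I ℤ.- F (k + 2 ∸ i) I)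
      (((ℤ.+ 3) ℤ.* ((ℤ.+ (k + 2)) ℤ.- (ℤ.+ (2 * i)))) / suc (suc k))
theorem3p20 k _ i 2≤i i≤k I isIdeal (suc p) (_ , periodic , _)
  with 2≤i′ , i′≤k , i+i′≡N ← complement-bounds {k} 2≤i i≤k =
  /-cross S (ℤ.+ 3 ℤ.* (ℤ.+ (k + 2) ℤ.- ℤ.+ (2 * i))) p (suc k) (begin
    S ℤ.* N k
      ≡⟨ ℤ.*-comm S (N k) ⟩
    N k ℤ.* S
      ≡⟨ orbitSum-coboundary i i′ 2≤i 2≤i′ i≤k i′≤k i+i′≡N I isIdeal (suc p) periodic ⟩
    ℤ.+ suc p ℤ.* (ℤ.+ 3 ℤ.* (ℤ.+ i′ ℤ.- ℤ.+ i))
      ≡⟨ ℤ.*-comm (ℤ.+ suc p) _ ⟩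
    ℤ.+ 3 ℤ.* (ℤ.+ i′ ℤ.- ℤ.+ i) ℤ.* ℤ.+ suc p
      ≡⟨ cong (λ d → ℤ.+ 3 ℤ.* d ℤ.* ℤ.+ suc p) (complement-difference i i′ i+i′≡N) ⟨
    ℤ.+ 3 ℤ.* (ℤ.+ (k + 2) ℤ.- ℤ.+ (2 * i)) ℤ.* ℤ.+ suc p ∎)
  where
  open ≡-Reasoning
  i′ = k + 2 ∸ i
  S = orbitSum (λ I → F i I ℤ.- F i′ I) I (suc p)
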